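{- Let $n,t$ be nonnegative integers with $t\le n-2$. Then (i) $c_{n, t+1}/c_{n, t} \le 2$; (ii) if $t \ge 2n/3$, then $c_{n, t+1}/c_{n, t} \le e/3$; (iii) if $n/2 \le t < 2n/3$, then $c_{n, t+1}/c_{n, t} \le 9/8$; (iv) $c_{n, t+1}/c_{n, t} \ge 1/n$.
   Context: For integers $0\le s\le n-1$, $c_{n,s}$ denotes the maximum of the product $q_1 q_2\cdots q_{n-s}$ over all $(n-s)$-tuples of positive integers $q_1,\dots,q_{n-s}$ with $q_1+\dots+q_{n-s}=n$ (equivalently, the maximum of the product of component sizes over spanning forests of $K_n$ with $s$ edges). -}

module Defs where

open import Data.Nat using (ℕ; zero; suc; _+_; _*_; _∸_; _≤_; _<_; _/_; _!)
open import Data.Nat.Properties using (_!≢0)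
open import Data.List using (List; length; map; upTo)
open import Data.Nat.ListAction using (sum; product)
open import Data.List.Relation.Unary.All using (All)
open import Data.Product using (_×_; Σ)
open import Relation.Binary.PropositionalEquality using (_≡_)

IsTuple : ℕ → ℕ → List ℕ → Set
IsTuple n k qs = (length qs ≡ k) × (All (λ q → 1 ≤ q) qs) × (sum qs ≡ n)

IsMaxProduct : ℕ → ℕ → ℕ → Set
IsMaxProduct n k m =
  Σ (List ℕ) (λ qs → IsTuple n k qs × product qs ≡ m)
  × (∀ qs → IsTuple n k qs → product qs ≤ m)

-- m is c_{n,s}: the maximum of the product over (n-s)-tuples of positive integers summing to n.
IsC : ℕ → ℕ → ℕ → Set
IsC n s m = IsMaxProduct n (n ∸ s) m

-- N! · Σ_{k=0}^{N} 1/k!  =  Σ_{k=0}^{N} N!/k!   (numerator of the N-th partial sum of e over N!)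
eNumer : ℕ → ℕ
eNumer N = sum (map (λ k → (N ! / k !) {{k !≢0}}) (upTo (suc N)))

{-# OPTIONS --safe #-}
-- Let k = n − t − 1, so b is the best product of k parts and a that of k + 1 parts; the
-- hypotheses of (iii) and (ii) say n ≥ 2(k + 1) and n ≥ 3(k + 1). Each bound comes from a
-- sum-preserving local move on an optimal tuple. Splitting a part q ≥ 2 into 1 and q − 1 turns
-- an optimal k-tuple into a (k + 1)-tuple of product ≥ b/2, giving (i); merging two parts of an
-- optimal (k + 1)-tuple (both ≤ n) costs at most a factor n, giving (iv). For (iii) split off a 2
-- from a part ≥ 4; if all parts are ≤ 3, then n ≥ 2(k + 1) forces two parts equal to 3, and
-- 3·3 is replaced by 2·2·2: either way the new product is ≥ 8b/9. For (ii) split off a 2 from a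
-- part ≥ 5, or else replace three parts 4 by four parts 3: the new product is ≥ 9b/8, and
-- 8/9 ≤ e/3.
module Submission where

open import Defs
open import Data.Nat using (ℕ; zero; suc; _+_; _*_; _≤_; _<_; _!; z≤n; z<s; s<s; _≤?_)
open import Data.Nat.Properties
open import Data.Nat.ListAction using (sum; product)
open import Data.Nat.ListAction.Properties using (sum-++; product-++; sum-↭; product-↭)
open import Data.Nat.Tactic.RingSolver using (solve-∀)
open import Algebra.Properties.CommutativeSemigroup +-commutativeSemigroup using (x∙yz≈y∙xz)
open import Data.List using ([]; _∷_; _++_; length; replicate)
open import Data.List.Properties using (length-++)
open import Data.List.Relation.Unary.All using (All; []; _∷_)
open import Data.List.Relation.Unary.All.Properties using (++⁺; ++⁻ʳ)
open import Data.List.Relation.Binary.Permutation.Propositional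
  using (_↭_; ↭-refl; ↭-prep; ↭-swap; ↭-trans)
open import Data.List.Relation.Binary.Permutation.Propositional.Properties
  using (All-resp-↭; ↭-length)
open import Data.Product using (_×_; ∃; ∃₂; _,_)
open import Data.Sum using (_⊎_; inj₁; inj₂)
open import Relation.Nullary using (yes; no; contradiction)
open import Relation.Binary.PropositionalEquality
  using (_≡_; refl; sym; trans; cong; subst; subst₂; module ≡-Reasoning)

Positive : ℕ → Set
Positive q = 1 ≤ q

ProductBound : ℕ → ℕ → ℕ → Set
ProductBound n k a = ∀ qs → IsTuple n k qs → product qs ≤ a

m*[n+o]≤[1+m]*n⇒[1+m]*o≤n+o : ∀ m n o → m * (n + o) ≤ suc m * n → suc m * o ≤ n + o
m*[n+o]≤[1+m]*n⇒[1+m]*o≤n+o m n o h = begin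
  o + m * o  ≤⟨ +-monoʳ-≤ o m*o≤n ⟩
  o + n      ≡⟨ +-comm o n ⟩
  n + o      ∎
  where
  open ≤-Reasoning
  m*o≤n : m * o ≤ n
  m*o≤n = +-cancelˡ-≤ (m * n) (m * o) n (begin
    m * n + m * o  ≡⟨ *-distribˡ-+ m n o ⟨
    m * (n + o)    ≤⟨ h ⟩
    n + m * n      ≡⟨ +-comm n (m * n) ⟩
    m * n + n      ∎)

sum≤*length : ∀ {m qs} → All (_≤ m) qs → sum qs ≤ m * length qs
sum≤*length {m} {[]}     []           = z≤n
sum≤*length {m} {q ∷ qs} (q≤m ∷ qs≤m) =
  subst (q + sum qs ≤_) (sym (*-suc m (length qs))) (+-mono-≤ q≤m (sum≤*length qs≤m))

all≤⊎pick> : ∀ m qs → All (_≤ m) qs ⊎ ∃₂ λ q rest → m < q × qs ↭ q ∷ rest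
all≤⊎pick> m []       = inj₁ []
all≤⊎pick> m (x ∷ xs) with x ≤? m | all≤⊎pick> m xs
... | no  x≰m | _                          = inj₂ (x , xs , ≰⇒> x≰m , ↭-refl)
... | yes x≤m | inj₁ xs≤m                  = inj₁ (x≤m ∷ xs≤m)
... | yes _   | inj₂ (q , rest , m<q , σ) =
  inj₂ (q , x ∷ rest , m<q , ↭-trans (↭-prep x σ) (↭-swap x q ↭-refl))

*length<sum⇒pick> : ∀ m qs → m * length qs < sum qs → ∃₂ λ q rest → m < q × qs ↭ q ∷ rest
*length<sum⇒pick> m qs excess with all≤⊎pick> m qs
... | inj₁ qs≤m = contradiction (sum≤*length qs≤m) (<⇒≱ excess)
... | inj₂ pick = pick

pick-replicate : ∀ B j qs → All (_≤ suc B) qs → B * length qs + j ≤ sum qs →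
                 ∃ λ rest → qs ↭ replicate j (suc B) ++ rest
pick-replicate B zero    qs _     _      = qs , ↭-refl
pick-replicate B (suc j) qs qs≤1+B excess
  with *length<sum⇒pick> B qs (<-≤-trans (m<m+n (B * length qs) z<s) excess)
... | q , rest , B<q , σ with All-resp-↭ σ qs≤1+B
... | q≤1+B ∷ rest≤1+B with ≤-antisym q≤1+B B<q
... | refl =
  let rest′ , τ = pick-replicate B j rest rest≤1+B excess′ in rest′ , ↭-trans σ (↭-prep (suc B) τ)
  where
  open ≤-Reasoning
  excess′ : B * length rest + j ≤ sum rest
  excess′ = +-cancelˡ-≤ (suc B) _ _ (begin
    suc B + (B * length rest + j)  ≡⟨ shuffle B (length rest) j ⟩
    B * suc (length rest) + suc j  ≡⟨ cong (λ l → B * l + suc j) (↭-length σ) ⟨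
    B * length qs + suc j          ≤⟨ excess ⟩
    sum qs                         ≡⟨ sum-↭ σ ⟩
    suc B + sum rest               ∎)
    where
    shuffle : ∀ B l j → suc B + (B * l + j) ≡ B * suc l + suc j
    shuffle = solve-∀

IsTuple-resp-↭ : ∀ {n k qs rs} → qs ↭ rs → IsTuple n k qs → IsTuple n k rs
IsTuple-resp-↭ σ (len , pos , total) =
  trans (sym (↭-length σ)) len , All-resp-↭ σ pos , trans (sym (sum-↭ σ)) total

exchange : ∀ {n k k′} xs ys rest →
           length ys + k ≡ length xs + k′ → All Positive ys → sum ys ≡ sum xs →
           IsTuple n k (xs ++ rest) → IsTuple n k′ (ys ++ rest)
exchange {n} {k} {k′} xs ys rest lengths ys-pos sums (len , pos , total) =
  trans (length-++ ys) (+-cancelˡ-≡ (length xs) _ _ (begin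
      length xs + (length ys + length rest)  ≡⟨ x∙yz≈y∙xz (length xs) (length ys) (length rest) ⟩
      length ys + (length xs + length rest)  ≡⟨ cong (length ys +_) (trans (sym (length-++ xs)) len) ⟩
      length ys + k                          ≡⟨ lengths ⟩
      length xs + k′                         ∎))
  , ++⁺ ys-pos (++⁻ʳ xs pos)
  , trans (sum-++ ys rest) (trans (cong (_+ sum rest) sums) (trans (sym (sum-++ xs rest)) total))
  where open ≡-Reasoning

exchange-≤ : ∀ {n k k′ a qs rest} c d xs ys → qs ↭ xs ++ rest → IsTuple n k qs →
             length ys + k ≡ length xs + k′ → All Positive ys → sum ys ≡ sum xs →
             c * product xs ≤ d * product ys → ProductBound n k′ a → c * product qs ≤ d * a
exchange-≤ {n} {k} {k′} {a} {qs} {rest} c d xs ys σ qs-tuple lengths ys-pos sums gain bound = begin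
  c * product qs                   ≡⟨ cong (c *_) (trans (product-↭ σ) (product-++ xs rest)) ⟩
  c * (product xs * product rest)  ≡⟨ *-assoc c _ _ ⟨
  c * product xs * product rest    ≤⟨ *-monoˡ-≤ (product rest) gain ⟩
  d * product ys * product rest    ≡⟨ *-assoc d _ _ ⟩
  d * (product ys * product rest)  ≡⟨ cong (d *_) (product-++ ys rest) ⟨
  d * product (ys ++ rest)         ≤⟨ *-monoʳ-≤ d (bound (ys ++ rest) refined) ⟩
  d * a                            ∎
  where
  open ≤-Reasoning
  refined : IsTuple n k′ (ys ++ rest)
  refined = exchange xs ys rest lengths ys-pos sums (IsTuple-resp-↭ σ qs-tuple)

split-gain : ∀ c d a u v → c * a ≤ d * u * v → c ≤ d * u →
             ∀ r → c * product (a + r ∷ []) ≤ d * product (u ∷ v + r ∷ [])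
split-gain c d a u v at-zero slope r = begin
  c * ((a + r) * 1)        ≡⟨ lhs c a r ⟩
  c * a + c * r            ≤⟨ +-mono-≤ at-zero (*-monoˡ-≤ r slope) ⟩
  d * u * v + d * u * r    ≡⟨ rhs d u v r ⟩
  d * (u * ((v + r) * 1))  ∎
  where
  open ≤-Reasoning
  lhs : ∀ c a r → c * ((a + r) * 1) ≡ c * a + c * r
  lhs = solve-∀
  rhs : ∀ d u v r → d * u * v + d * u * r ≡ d * (u * ((v + r) * 1))
  rhs = solve-∀

merge-gain : ∀ {n} x y → x ≤ n → 1 * product (x ∷ y ∷ []) ≤ n * product (x + y ∷ [])
merge-gain {n} x y x≤n = begin
  1 * (x * (y * 1))  ≡⟨ lhs x y ⟩
  x * y              ≤⟨ *-mono-≤ x≤n (m≤n+m y x) ⟩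
  n * (x + y)        ≡⟨ rhs n x y ⟩
  n * ((x + y) * 1)  ∎
  where
  open ≤-Reasoning
  lhs : ∀ x y → 1 * (x * (y * 1)) ≡ x * y
  lhs = solve-∀
  rhs : ∀ n x y → n * (x + y) ≡ n * ((x + y) * 1)
  rhs = solve-∀

B*[1+k]≤n⇒B*length+B≤sum : ∀ {B n k qs} → IsTuple n k qs → B * suc k ≤ n →
                            B * length qs + B ≤ sum qs
B*[1+k]≤n⇒B*length+B≤sum {B} {n} {k} (len , _ , total) h =
  subst₂ _≤_ (trans (*-suc B k) (trans (+-comm B (B * k)) (cong (λ l → B * l + B) (sym len))))
             (sym total) h

product≤2*refinedMax : ∀ {n k a qs} → IsTuple n k qs → k < n → ProductBound n (suc k) a →
                       product qs ≤ 2 * a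
product≤2*refinedMax {n} {k} {a} {qs} tuple@(len , _ , total) k<n bound
  with *length<sum⇒pick> 1 qs
         (subst₂ _<_ (sym (trans (*-identityˡ (length qs)) len)) (sym total) k<n)
... | suc (suc r) , rest , s<s z<s , σ =
  subst (_≤ 2 * a) (*-identityˡ (product qs))
    (exchange-≤ 1 2 (2 + r ∷ []) (1 ∷ 1 + r ∷ []) σ tuple refl (z<s ∷ z<s ∷ []) refl
      (split-gain 1 2 2 1 1 (m≤m+n 2 0) (m≤m+n 1 1) r) bound)

8*product≤9*refinedMax : ∀ {n k a qs} → IsTuple n k qs → 2 * suc k ≤ n → ProductBound n (suc k) a →
                         8 * product qs ≤ 9 * a
8*product≤9*refinedMax {qs = qs} tuple n≥2[k+1] bound with all≤⊎pick> 3 qs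
... | inj₂ (suc (suc (suc (suc r))) , rest , s<s (s<s (s<s z<s)) , σ) =
  exchange-≤ 8 9 (4 + r ∷ []) (2 ∷ 2 + r ∷ []) σ tuple refl (z<s ∷ z<s ∷ []) refl
    (split-gain 8 9 4 2 2 (m≤m+n 32 4) (m≤m+n 8 10) r) bound
... | inj₁ qs≤3 with pick-replicate 2 2 qs qs≤3 (B*[1+k]≤n⇒B*length+B≤sum tuple n≥2[k+1])
... | rest , σ =
  exchange-≤ 8 9 (3 ∷ 3 ∷ []) (2 ∷ 2 ∷ 2 ∷ []) σ tuple refl (z<s ∷ z<s ∷ z<s ∷ []) refl
    ≤-refl bound

9*product≤8*refinedMax : ∀ {n k a qs} → IsTuple n k qs → 3 * suc k ≤ n → ProductBound n (suc k) a →
                         9 * product qs ≤ 8 * a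
9*product≤8*refinedMax {qs = qs} tuple n≥3[k+1] bound with all≤⊎pick> 4 qs
... | inj₂ (suc (suc (suc (suc (suc r)))) , rest , s<s (s<s (s<s (s<s z<s))) , σ) =
  exchange-≤ 9 8 (5 + r ∷ []) (2 ∷ 3 + r ∷ []) σ tuple refl (z<s ∷ z<s ∷ []) refl
    (split-gain 9 8 5 2 3 (m≤m+n 45 3) (m≤m+n 9 7) r) bound
... | inj₁ qs≤4 with pick-replicate 3 3 qs qs≤4 (B*[1+k]≤n⇒B*length+B≤sum tuple n≥3[k+1])
... | rest , σ =
  exchange-≤ 9 8 (4 ∷ 4 ∷ 4 ∷ []) (3 ∷ 3 ∷ 3 ∷ 3 ∷ []) σ tuple refl
    (z<s ∷ z<s ∷ z<s ∷ z<s ∷ []) refl (m≤m+n 576 72) bound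

product≤n*coarsenedMax : ∀ {n k b qs} → IsTuple n (2 + k) qs → ProductBound n (suc k) b →
                         product qs ≤ n * b
product≤n*coarsenedMax {n} {k} {b} {x ∷ y ∷ rest} tuple@(_ , x-pos ∷ _ , total) bound =
  subst (_≤ n * b) (*-identityˡ _)
    (exchange-≤ 1 n (x ∷ y ∷ []) (x + y ∷ []) ↭-refl tuple refl (≤-trans x-pos (m≤m+n x y) ∷ [])
      (+-assoc x y 0) (merge-gain x y (subst (x ≤_) total (m≤m+n x (y + sum rest)))) bound)

maxProduct-ratios : ∀ {n k a b} → IsMaxProduct n (2 + k) a → IsMaxProduct n (suc k) b →
  (suc k < n → b ≤ 2 * a)
  × (3 * (2 + k) ≤ n → 9 * b ≤ 8 * a)
  × (2 * (2 + k) ≤ n → 8 * b ≤ 9 * a)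
  × (a ≤ n * b)
maxProduct-ratios ((_ , tupleₐ , refl) , boundₐ) ((_ , tuple_b , refl) , bound_b) =
    (λ k<n → product≤2*refinedMax tuple_b k<n boundₐ)
  , (λ n≥3[k+2] → 9*product≤8*refinedMax tuple_b n≥3[k+2] boundₐ)
  , (λ n≥2[k+2] → 8*product≤9*refinedMax tuple_b n≥2[k+2] boundₐ)
  , product≤n*coarsenedMax tupleₐ bound_b

-- 8/9 = (1 + 1 + 1/2 + 1/6)/3, the third partial sum of e divided by 3.
9*b≤8*a⇒3*b*3!≤a*eNumer[3] : ∀ {a b} → 9 * b ≤ 8 * a → 3 * b * 3 ! ≤ a * eNumer 3
9*b≤8*a⇒3*b*3!≤a*eNumer[3] {a} {b} h = begin
  3 * b * 6    ≡⟨ lhs b ⟩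
  2 * (9 * b)  ≤⟨ *-monoʳ-≤ 2 h ⟩
  2 * (8 * a)  ≡⟨ rhs a ⟩
  a * 16       ∎
  where
  open ≤-Reasoning
  lhs : ∀ b → 3 * b * 6 ≡ 2 * (9 * b)
  lhs = solve-∀
  rhs : ∀ a → 2 * (8 * a) ≡ a * 16
  rhs = solve-∀

≤⇒≡+ : ∀ {m n} o → m + o ≤ n → ∃ λ k → n ≡ m + (o + k)
≤⇒≡+ {m} o m+o≤n with m≤n⇒∃[o]m+o≡n m+o≤n
... | k , refl = k , +-assoc m o k

lemma8 : (n t : ℕ) → t + 2 ≤ n → (a b : ℕ) → IsC n t a → IsC n (t + 1) b →
    (b ≤ 2 * a)
    × (2 * n ≤ 3 * t → ∃ (λ N → 3 * b * N ! ≤ a * eNumer N))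
    × (n ≤ 2 * t → 3 * t < 2 * n → 8 * b ≤ 9 * a)
    × (a ≤ n * b)
lemma8 n t t+2≤n a b cₐ c_b with ≤⇒≡+ 2 t+2≤n
... | m , refl
  with maxProduct-ratios
         (subst (λ k → IsMaxProduct (t + (2 + m)) k a) (m+n∸m≡n t (2 + m)) cₐ)
         (subst (λ k → IsMaxProduct (t + (2 + m)) k b) ([m+n]∸[m+o]≡n∸o t (2 + m) 1) c_b)
... | b≤2a , 9b≤8a , 8b≤9a , a≤nb =
    b≤2a (m≤n+m (2 + m) t)
  , (λ 2n≤3t → 3 , 9*b≤8*a⇒3*b*3!≤a*eNumer[3] {a} {b}
                     (9b≤8a (m*[n+o]≤[1+m]*n⇒[1+m]*o≤n+o 2 t (2 + m) 2n≤3t)))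
  -- (iii) holds without its upper bound 3t < 2n, which only separates it from (ii).
  , (λ n≤2t _ → 8b≤9a (m*[n+o]≤[1+m]*n⇒[1+m]*o≤n+o 1 t (2 + m)
                         (subst (_≤ 2 * t) (sym (*-identityˡ _)) n≤2t)))
  , a≤nb
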